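{- Let $F$ be a finite field of characteristic $2$ with $[F:\mathbb{F}_2]$ odd, and let $d$ be a positive integer with $\gcd(d,|F|-1)=1$. Then there is some $a \in F^*$ such that $\left|\sum_{x\in F}(-1)^{\operatorname{Tr}(x^d-ax)}\right| \geq \sqrt{2|F|}$, where $\operatorname{Tr}\colon F\to\mathbb{F}_2$ is the absolute trace. -}

module Defs where

open import Level using (Level; _⊔_; suc)
open import Algebra.Bundles using (CommutativeRing)
open import Data.Nat as ℕ using (ℕ; zero) renaming (suc to 1+)
open import Data.Integer as ℤ using (ℤ; +_; -[1+_])
open import Data.List using (List; []; _∷_; length; map; upTo)
open import Data.List.Relation.Unary.Any using (Any)
open import Data.List.Relation.Unary.AllPairs using (AllPairs)
open import Data.Product using (Σ; _×_)
open import Relation.Nullary using (¬_; Dec; yes; no)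
open import Relation.Binary.Definitions using (Decidable)

record FiniteField c ℓ : Set (suc (c ⊔ ℓ)) where
  field
    commRing : CommutativeRing c ℓ
  open CommutativeRing commRing public
  field
    1≉0      : ¬ (1# ≈ 0#)
    inverse  : ∀ x → ¬ (x ≈ 0#) → Σ Carrier (λ y → x * y ≈ 1#)
    _≟_      : Decidable _≈_
    elements : List Carrier
    complete : ∀ x → Any (x ≈_) elements
    distinct : AllPairs (λ u v → ¬ (u ≈ v)) elements

module _ {c ℓ} (F : FiniteField c ℓ) where
  open FiniteField F

  card : ℕ
  card = length elements

  pow : Carrier → ℕ → Carrier
  pow x zero = 1#
  pow x (1+ k) = x * pow x k

  Char2 : Set ℓ
  Char2 = 1# + 1# ≈ 0#

  sumF : List Carrier → Carrier
  sumF [] = 0#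
  sumF (y ∷ ys) = y + sumF ys

  -- Absolute trace F → F₂ (⊆ F) for a field with |F| = 2^n, n = [F : F₂]:
  -- Tr(x) = x + x^2 + x^4 + ... + x^(2^(n-1))
  Tr : ℕ → Carrier → Carrier
  Tr n x = sumF (map (λ i → pow x (2 ℕ.^ i)) (upTo n))

  -- (-1)^Tr(y), where Tr(y) ∈ F₂ = {0, 1}
  sign : ℕ → Carrier → ℤ
  sign n y with Tr n y ≟ 0#
  ... | yes _ = + 1
  ... | no  _ = -[1+ 0 ]

  sumℤ : List ℤ → ℤ
  sumℤ [] = + 0
  sumℤ (z ∷ zs) = z ℤ.+ sumℤ zs

  walsh : ℕ → ℕ → Carrier → ℤ
  walsh n d a = sumℤ (map (λ x → sign n (pow x d - a * x)) elements)

-- Fourth-moment argument.  Put W(b, a) = Σₓ (-1)^Tr(b x^d + a x), so the sum in the theorem is W(1, a).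
-- Orthogonality of the additive character turns Σ_{b,a} W(b, a)⁴ into q² times the number of solutions
-- of x + y = z + w, x^d + y^d = z^d + w^d, and the solutions with {x, y} = {z, w} or with x = y, z = w
-- already number 3q² - 2q.
-- Since x ↦ x^d is a bijection (gcd(d, q - 1) = 1), W(c^d, a c) = W(1, a) for c ≠ 0, while W(0, a) is
-- q [a = 0]; so Σ_{b,a} W(b, a)⁴ = q⁴ + (q - 1) Σₐ W(1, a)⁴ and hence Σₐ W(1, a)⁴ ≥ 2q³.  But W(1, 0) = 0
-- and Σₐ W(1, a)² = q² (Parseval), so W(1, a)² < 2q for all a ≠ 0 would force Σₐ W(1, a)⁴ < 2q³.
-- The parity of n is only needed to ensure q ≥ 2.

{-# OPTIONS --safe #-}
module Submission where

open import Defs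
open import Algebra.Bundles using (CommutativeMonoid)
open import Data.Nat as ℕ using (ℕ; zero; suc; _∸_)
import Data.Nat.Properties as ℕP
open import Data.Nat.GCD using (gcd; GCD; gcd-GCD; module Bézout)
open import Data.List using (List; []; _∷_; _∷ʳ_; length; map; foldr; upTo)
import Data.List.Properties as List
open import Data.List.Relation.Unary.Any as Any using (Any; here; there; any?; satisfied)
open import Data.List.Relation.Unary.All using (All; []; _∷_)
open import Data.List.Relation.Unary.AllPairs using (_∷_)
open import Data.Product using (Σ; ∃; _,_; proj₂; _×_)
open import Data.Sum using (_⊎_; inj₁; inj₂)
open import Function using (_∘_; id)
open import Relation.Binary.Bundles using (Setoid)
open import Relation.Binary.PropositionalEquality as ≡ using (_≡_)
open import Relation.Nullary using (¬_; Dec; yes; no; ¬?)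
open import Relation.Nullary.Decidable using (_×-dec_)
open import Relation.Nullary.Negation using (contradiction)

module UniqueList {a e} (S : Setoid a e) where

  open Setoid S renaming (Carrier to A)
  open import Data.List.Membership.Setoid S using (_∈_; _─_)
  open import Data.List.Membership.Setoid.Properties using (∈-map⁻; ∈-resp-≈)
  open import Data.List.Relation.Binary.Permutation.Setoid S
    using (_↭_; prep; ↭-refl; ↭-sym; ↭-trans; ↭-prep; ↭-swap)
  import Data.List.Relation.Binary.Permutation.Setoid.Properties as ↭
  open import Data.List.Relation.Unary.Unique.Setoid S using (Unique)
  import Data.List.Relation.Unary.Unique.Setoid.Properties as Unique

  ↭-─ : ∀ {x} xs (p : x ∈ xs) → xs ↭ x ∷ (xs ─ p)
  ↭-─ (y ∷ xs) (here x≈y) = prep (sym x≈y) ↭-refl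
  ↭-─ (y ∷ xs) (there p)  = ↭-trans (↭-prep y (↭-─ xs p)) (↭-swap y _ ↭-refl)

  ∈-─ : ∀ {x z} xs (p : x ∈ xs) → z ∈ xs → ¬ z ≈ x → z ∈ xs ─ p
  ∈-─ (y ∷ xs) (here x≈y) (here z≈y) z≉x = contradiction (trans z≈y (sym x≈y)) z≉x
  ∈-─ (y ∷ xs) (here _)   (there q)  _   = q
  ∈-─ (y ∷ xs) (there _)  (here z≈y) _   = here z≈y
  ∈-─ (y ∷ xs) (there p)  (there q)  z≉x = there (∈-─ xs p q z≉x)

  ∉-head : ∀ {x z xs} → All (λ y → ¬ x ≈ y) xs → z ∈ xs → ¬ z ≈ x
  ∉-head (x≉y ∷ _)   (here z≈y) z≈x = x≉y (trans (sym z≈x) z≈y)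
  ∉-head (_ ∷ x≉xs) (there z∈xs)    = ∉-head x≉xs z∈xs

  unique-⊆⇒↭ : ∀ {xs ys} → Unique xs → (∀ {z} → z ∈ xs → z ∈ ys) →
               length xs ≡ length ys → xs ↭ ys
  unique-⊆⇒↭ {[]}     {[]}    _ _ _ = ↭-refl
  unique-⊆⇒↭ {x ∷ xs} {ys} (x≉xs ∷ xs!) xs⊆ys |xs|≡|ys| =
    ↭-trans (prep refl (unique-⊆⇒↭ xs! xs⊆ys─x∈ys |xs|≡|ys─x∈ys|)) (↭-sym (↭-─ ys x∈ys))
    where
    x∈ys = xs⊆ys (here refl)
    xs⊆ys─x∈ys : ∀ {z} → z ∈ xs → z ∈ ys ─ x∈ys
    xs⊆ys─x∈ys z∈xs = ∈-─ ys x∈ys (xs⊆ys (there z∈xs)) (∉-head x≉xs z∈xs)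
    |xs|≡|ys─x∈ys| : length xs ≡ length (ys ─ x∈ys)
    |xs|≡|ys─x∈ys| = ℕP.suc-injective (≡.trans |xs|≡|ys| (List.length-removeAt′ ys _))

  map-↭ : ∀ {xs} {h : A → A} → Unique xs → (∀ {x} → x ∈ xs → h x ∈ xs) →
          (∀ {x y} → h x ≈ h y → x ≈ y) → map h xs ↭ xs
  map-↭ {xs} {h} xs! h-into h-inj =
    unique-⊆⇒↭ (Unique.map⁺ S S h-inj xs!) hxs⊆xs (List.length-map h xs)
    where
    hxs⊆xs : ∀ {z} → z ∈ map h xs → z ∈ xs
    hxs⊆xs z∈hxs = let _ , x∈xs , z≈hx = ∈-map⁻ S S z∈hxs in ∈-resp-≈ S (sym z≈hx) (h-into x∈xs)

  unique-∷-─ : ∀ {x xs} → Unique xs → (x∈xs : x ∈ xs) → Unique (x ∷ xs ─ x∈xs)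
  unique-∷-─ {xs = xs} xs! x∈xs = ↭.Unique-resp-↭ S (↭-─ xs x∈xs) xs!

  unique-─ : ∀ {x xs} → Unique xs → (x∈xs : x ∈ xs) → Unique (xs ─ x∈xs)
  unique-─ xs! x∈xs with unique-∷-─ xs! x∈xs
  ... | _ ∷ xs─x! = xs─x!

  ∈-─⇒≉ : ∀ {x z xs} → Unique xs → (x∈xs : x ∈ xs) → z ∈ xs ─ x∈xs → ¬ z ≈ x
  ∈-─⇒≉ xs! x∈xs with unique-∷-─ xs! x∈xs
  ... | x≉xs─x ∷ _ = ∉-head x≉xs─x

  injective⇒surjective : ∀ {xs} {h : A → A} → Unique xs → (∀ x → x ∈ xs) →
                         (∀ {x y} → h x ≈ h y → x ≈ y) → ∀ y → ∃ λ x → y ≈ h x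
  injective⇒surjective {xs} {h} xs! complete h-inj y =
    let hxs↭xs = map-↭ xs! (λ {x} _ → complete (h x)) h-inj
        x , _ , y≈hx = ∈-map⁻ S S (↭.∈-resp-↭ S (↭-sym hxs↭xs) (complete y))
    in x , y≈hx

module ListSum {a e m r} (S : Setoid a e) (M : CommutativeMonoid m r) where

  open Setoid S using () renaming (Carrier to A; _≈_ to _≈ᴬ_)
  open CommutativeMonoid M renaming (Carrier to C)
  open import Relation.Binary.Reasoning.Setoid setoid
  open import Data.List.Membership.Setoid S using (_∈_; _─_)
  open import Data.List.Relation.Binary.Permutation.Setoid S using (_↭_)
  import Data.List.Relation.Binary.Permutation.Setoid.Properties as ↭
  open import Data.List.Relation.Unary.Unique.Setoid S using (Unique)
  open UniqueList S using (map-↭; ↭-─; ∈-─⇒≉)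
  private module S = Setoid S
  open import Function.Definitions using (Congruent)

  ∑ : List A → (A → C) → C
  ∑ xs g = foldr _∙_ ε (map g xs)

  ∑-cong : ∀ {f g} xs → (∀ x → f x ≈ g x) → ∑ xs f ≈ ∑ xs g
  ∑-cong []       f≈g = refl
  ∑-cong (x ∷ xs) f≈g = ∙-cong (f≈g x) (∑-cong xs f≈g)

  ∑-ε : ∀ xs → ∑ xs (λ _ → ε) ≈ ε
  ∑-ε []       = refl
  ∑-ε (x ∷ xs) = trans (identityˡ _) (∑-ε xs)

  ∑-∙ : ∀ {f g} xs → ∑ xs (λ x → f x ∙ g x) ≈ ∑ xs f ∙ ∑ xs g
  ∑-∙ []                 = sym (identityˡ ε)
  ∑-∙ {f} {g} (x ∷ xs) = begin
    (f x ∙ g x) ∙ ∑ xs (λ x → f x ∙ g x) ≈⟨ ∙-congˡ (∑-∙ xs) ⟩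
    (f x ∙ g x) ∙ (∑ xs f ∙ ∑ xs g)      ≈⟨ interchange (f x) (g x) (∑ xs f) (∑ xs g) ⟩
    (f x ∙ ∑ xs f) ∙ (g x ∙ ∑ xs g)      ∎
    where open import Algebra.Properties.CommutativeSemigroup commutativeSemigroup using (interchange)

  ∑-swap : ∀ {g : A → A → C} xs ys →
           ∑ xs (λ x → ∑ ys (g x)) ≈ ∑ ys (λ y → ∑ xs (λ x → g x y))
  ∑-swap []       ys = sym (∑-ε ys)
  ∑-swap (x ∷ xs) ys = trans (∙-congˡ (∑-swap xs ys)) (sym (∑-∙ ys))

  ∑-pull : ∀ {H : A → A → A → C} xs ys zs →
           ∑ xs (λ b → ∑ ys (λ a → ∑ zs (H b a))) ≈ ∑ zs (λ x → ∑ xs (λ b → ∑ ys (λ a → H b a x)))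
  ∑-pull xs ys zs = trans (∑-cong xs (λ b → ∑-swap ys zs)) (∑-swap xs zs)

  ∑-↭ : ∀ {g xs ys} → Congruent _≈ᴬ_ _≈_ g → xs ↭ ys → ∑ xs g ≈ ∑ ys g
  ∑-↭ g-cong xs↭ys = ↭.foldr-commMonoid setoid isCommutativeMonoid (↭.map⁺ S setoid g-cong xs↭ys)

  ∑-reindex : ∀ {g xs} (h : A → A) → Congruent _≈ᴬ_ _≈_ g → Unique xs →
              (∀ {x} → x ∈ xs → h x ∈ xs) → (∀ {x y} → h x ≈ᴬ h y → x ≈ᴬ y) →
              ∑ xs (g ∘ h) ≈ ∑ xs g
  ∑-reindex {g} {xs} h g-cong xs! h-into h-inj = begin
    ∑ xs (g ∘ h)           ≡⟨ ≡.cong (foldr _∙_ ε) (List.map-∘ xs) ⟩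
    ∑ (map h xs) g         ≈⟨ ∑-↭ g-cong (map-↭ xs! h-into h-inj) ⟩
    ∑ xs g                 ∎

  ∑-∷ʳ : ∀ {g} xs x → ∑ (xs ∷ʳ x) g ≈ ∑ xs g ∙ g x
  ∑-∷ʳ []       x = trans (identityʳ _) (sym (identityˡ _))
  ∑-∷ʳ (y ∷ xs) x = trans (∙-congˡ (∑-∷ʳ xs x)) (sym (assoc _ _ _))

  ∑-─ : ∀ {g x xs} → Congruent _≈ᴬ_ _≈_ g → (x∈xs : x ∈ xs) → ∑ xs g ≈ g x ∙ ∑ (xs ─ x∈xs) g
  ∑-─ {xs = xs} g-cong x∈xs = ∑-↭ g-cong (↭-─ xs x∈xs)

  ∑-cong-∈ : ∀ {f g} xs → (∀ {x} → x ∈ xs → f x ≈ g x) → ∑ xs f ≈ ∑ xs g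
  ∑-cong-∈ []       f≈g = refl
  ∑-cong-∈ (x ∷ xs) f≈g = ∙-cong (f≈g (here S.refl)) (∑-cong-∈ xs (f≈g ∘ there))

  ∑-single : ∀ {g x xs} → Congruent _≈ᴬ_ _≈_ g → Unique xs → x ∈ xs →
             (∀ y → ¬ y ≈ᴬ x → g y ≈ ε) → ∑ xs g ≈ g x
  ∑-single {g} {x} {xs} g-cong xs! x∈xs g≈ε = begin
    ∑ xs g                          ≈⟨ ∑-─ g-cong x∈xs ⟩
    g x ∙ ∑ (xs ─ x∈xs) g           ≈⟨ ∙-congˡ (∑-cong-∈ (xs ─ x∈xs) (g≈ε _ ∘ ∈-─⇒≉ xs! x∈xs)) ⟩
    g x ∙ ∑ (xs ─ x∈xs) (λ _ → ε)   ≈⟨ ∙-congˡ (∑-ε (xs ─ x∈xs)) ⟩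
    g x ∙ ε                         ≈⟨ identityʳ (g x) ⟩
    g x                             ∎

module IntegerSum {a e} (S : Setoid a e) where

  open import Data.Integer as ℤ using (ℤ; +_; _+_; _*_; _≤_; +≤+)
  import Data.Integer.Properties as ℤP
  open Setoid S using (refl) renaming (Carrier to A; _≈_ to _≈ᴬ_)
  open import Data.List.Membership.Setoid S using (_∈_; _─_)
  open import Function.Definitions using (Congruent)
  open UniqueList S using (∈-─)
  open ListSum S ℤP.+-0-commutativeMonoid public

  ∑-*ˡ : ∀ k {g} xs → k * ∑ xs g ≡ ∑ xs (λ x → k * g x)
  ∑-*ˡ k []           = ℤP.*-zeroʳ k
  ∑-*ˡ k {g} (x ∷ xs) = ≡.trans (ℤP.*-distribˡ-+ k (g x) (∑ xs g)) (≡.cong (_+_ (k * g x)) (∑-*ˡ k xs))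

  ∑-*ʳ : ∀ k {g} xs → ∑ xs g * k ≡ ∑ xs (λ x → g x * k)
  ∑-*ʳ k {g} xs = begin
    ∑ xs g * k              ≡⟨ ℤP.*-comm (∑ xs g) k ⟩
    k * ∑ xs g              ≡⟨ ∑-*ˡ k xs ⟩
    ∑ xs (λ x → k * g x)    ≡⟨ ∑-cong xs (λ x → ℤP.*-comm k (g x)) ⟩
    ∑ xs (λ x → g x * k)    ∎
    where open ≡.≡-Reasoning

  ∑-product : ∀ {g h} xs ys → ∑ xs g * ∑ ys h ≡ ∑ xs (λ x → ∑ ys (λ y → g x * h y))
  ∑-product {g} {h} xs ys = ≡.trans (∑-*ʳ (∑ ys h) xs) (∑-cong xs (λ x → ∑-*ˡ (g x) ys))

  ∑-const : ∀ k xs → ∑ xs (λ _ → k) ≡ + length xs * k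
  ∑-const k []       = ≡.refl
  ∑-const k (x ∷ xs) = begin
    k + ∑ xs (λ _ → k)        ≡⟨ ≡.cong (_+_ k) (∑-const k xs) ⟩
    k + + length xs * k       ≡⟨ ≡.cong (_+ + length xs * k) (ℤP.*-identityˡ k) ⟨
    + 1 * k + + length xs * k ≡⟨ ℤP.*-distribʳ-+ k (+ 1) (+ length xs) ⟨
    + suc (length xs) * k     ∎
    where open ≡.≡-Reasoning

  ∑-mono-≤ : ∀ {f g} xs → (∀ {x} → x ∈ xs → f x ≤ g x) → ∑ xs f ≤ ∑ xs g
  ∑-mono-≤ []       _   = ℤP.≤-refl
  ∑-mono-≤ (x ∷ xs) f≤g = ℤP.+-mono-≤ (f≤g (here refl)) (∑-mono-≤ xs (f≤g ∘ there))

  ∑-nonNeg : ∀ {g} xs → (∀ x → + 0 ≤ g x) → + 0 ≤ ∑ xs g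
  ∑-nonNeg xs 0≤g = ℤP.≤-trans (ℤP.≤-reflexive (≡.sym (∑-ε xs))) (∑-mono-≤ xs (λ {x} _ → 0≤g x))

  ∑-≥-term : ∀ {g x xs} → Congruent _≈ᴬ_ _≡_ g → (∀ x → + 0 ≤ g x) → x ∈ xs → g x ≤ ∑ xs g
  ∑-≥-term {g} {x} {xs} g-cong 0≤g x∈xs = begin
    g x                       ≡⟨ ℤP.+-identityʳ (g x) ⟨
    g x + + 0                 ≤⟨ ℤP.+-monoʳ-≤ (g x) (∑-nonNeg (xs ─ x∈xs) 0≤g) ⟩
    g x + ∑ (xs ─ x∈xs) g     ≡⟨ ∑-─ g-cong x∈xs ⟨
    ∑ xs g                    ∎
    where open ℤP.≤-Reasoning

  ∑-≥-pair : ∀ {g x y xs} → Congruent _≈ᴬ_ _≡_ g → (∀ x → + 0 ≤ g x) →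
             x ∈ xs → y ∈ xs → ¬ y ≈ᴬ x → g x + g y ≤ ∑ xs g
  ∑-≥-pair {g} {x} {y} {xs} g-cong 0≤g x∈xs y∈xs y≉x = begin
    g x + g y                 ≤⟨ ℤP.+-monoʳ-≤ (g x) (∑-≥-term g-cong 0≤g (∈-─ xs x∈xs y∈xs y≉x)) ⟩
    g x + ∑ (xs ─ x∈xs) g     ≡⟨ ∑-─ g-cong x∈xs ⟨
    ∑ xs g                    ∎
    where open ℤP.≤-Reasoning

module IntegerArithmetic where

  open import Data.Integer as ℤ using (ℤ; +_; _+_; _*_; _≤_; _<_; +≤+; +<+)
  import Data.Integer.Properties as ℤP
  open import Data.Integer.Tactic.RingSolver using (solve-∀)
  open import Data.Empty using (⊥)

  infix 8 _² _⁴
  _² _⁴ : ℤ → ℤ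
  i ² = i * i
  i ⁴ = (i ²) ²

  i²≡+∣i∣^2 : ∀ i → i ² ≡ + (ℤ.∣ i ∣ ℕ.^ 2)
  i²≡+∣i∣^2 (+ m)       =
    ≡.trans (≡.sym (ℤP.pos-* m m)) (≡.cong (λ k → + (m ℕ.* k)) (≡.sym (ℕP.*-identityʳ m)))
  i²≡+∣i∣^2 ℤ.-[1+ m ] = ≡.cong (λ k → + (suc m ℕ.* k)) (≡.sym (ℕP.*-identityʳ (suc m)))

  i²-nonNeg : ∀ i → + 0 ≤ i ²
  i²-nonNeg i = ≡.subst (+ 0 ≤_) (≡.sym (i²≡+∣i∣^2 i)) (+≤+ ℕ.z≤n)

  *-nonNeg : ∀ {i j} → + 0 ≤ i → + 0 ≤ j → + 0 ≤ i * j
  *-nonNeg {i} {j} 0≤i 0≤j =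
    ≡.subst (_≤ i * j) (ℤP.*-zeroʳ i) (ℤP.*-monoˡ-≤-nonNeg i {{ℤ.nonNegative 0≤i}} 0≤j)

  private
    identity : ∀ M → let Q = + 1 + M in
      (Q * Q * (Q * Q) + M * (M + Q) * (Q * Q)) + M * (Q * Q) ≡ Q * (Q * (Q * Q) + M * (Q * Q + Q * Q))
    identity = solve-∀

  -- With M = Q - 1 > 0 the hypotheses bound Q ⁴ + M s below by Q ⁴ + 2 M Q³ and above by Q ⁴ + 2 M Q³ - M Q².
  moment-bounds-incompatible : ∀ {q m} s → q ≡ suc m → 1 ℕ.≤ m → let Q = + q; M = + m in
    Q * (Q * Q ² + M * (Q ² + Q ²)) ≤ Q ⁴ + M * s → s ≤ (M + Q) * Q ² → ⊥
  moment-bounds-incompatible {m = suc k} s ≡.refl _ lower upper =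
    ℤP.<-irrefl ≡.refl (ℤP.≤-<-trans lower′ R<LHS)
    where
    Q = + suc (suc k)
    M = + suc k
    R = Q ⁴ + M * (M + Q) * Q ²
    lower′ : Q * (Q * Q ² + M * (Q ² + Q ²)) ≤ R
    lower′ = ℤP.≤-trans lower (ℤP.+-monoʳ-≤ (Q ⁴) (≡.subst (M * s ≤_) (≡.sym (ℤP.*-assoc M (M + Q) (Q ²)))
                                                        (ℤP.*-monoˡ-≤-nonNeg M upper)))
    R<LHS : R < Q * (Q * Q ² + M * (Q ² + Q ²))
    R<LHS = ≡.subst₂ _<_ (ℤP.+-identityʳ R) (identity M) (ℤP.+-monoʳ-< R (+<+ (ℕ.s≤s ℕ.z≤n)))

module FiniteFieldProperties {c ℓ} (F : FiniteField c ℓ) where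

  open FiniteField F
  open import Algebra.Properties.CommutativeSemiring.Exp commutativeSemiring public
    using (_^_; ^-congˡ; ^-assocʳ; ^-distrib-*)
  open import Relation.Binary.Reasoning.Setoid setoid
  open import Data.List.Relation.Unary.Unique.Setoid setoid using (Unique)
  open import Data.List.Membership.Setoid setoid using (_∈_; _─_)
  open UniqueList setoid using (∈-─; unique-─; ∈-─⇒≉; injective⇒surjective)
  open ListSum setoid *-commutativeMonoid renaming (∑ to ∏; ∑-∙ to ∏-*; ∑-reindex to ∏-reindex)

  q : ℕ
  q = card F

  pow≡^ : ∀ x k → pow F x k ≡ x ^ k
  pow≡^ x zero    = ≡.refl
  pow≡^ x (suc k) = ≡.cong (x *_) (pow≡^ x k)

  *-cancelʳ-nonZero : ∀ {x y z} → ¬ z ≈ 0# → x * z ≈ y * z → x ≈ y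
  *-cancelʳ-nonZero {x} {y} {z} z≉0 xz≈yz = let z⁻¹ , zz⁻¹≈1 = inverse z z≉0 in begin
    x               ≈⟨ *-identityʳ x ⟨
    x * 1#          ≈⟨ *-congˡ zz⁻¹≈1 ⟨
    x * (z * z⁻¹)   ≈⟨ *-assoc x z z⁻¹ ⟨
    (x * z) * z⁻¹   ≈⟨ *-congʳ xz≈yz ⟩
    (y * z) * z⁻¹   ≈⟨ *-assoc y z z⁻¹ ⟩
    y * (z * z⁻¹)   ≈⟨ *-congˡ zz⁻¹≈1 ⟩
    y * 1#          ≈⟨ *-identityʳ y ⟩
    y               ∎

  *-cancelˡ-nonZero : ∀ {x y z} → ¬ z ≈ 0# → z * x ≈ z * y → x ≈ y
  *-cancelˡ-nonZero z≉0 zx≈zy = *-cancelʳ-nonZero z≉0 (trans (*-comm _ _) (trans zx≈zy (*-comm _ _)))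

  *-nonZero : ∀ {x y} → ¬ x ≈ 0# → ¬ y ≈ 0# → ¬ x * y ≈ 0#
  *-nonZero {x} {y} x≉0 y≉0 xy≈0 = y≉0 (*-cancelˡ-nonZero x≉0 (trans xy≈0 (sym (zeroʳ x))))

  ^-nonZero : ∀ {x} k → ¬ x ≈ 0# → ¬ x ^ k ≈ 0#
  ^-nonZero zero    _   = 1≉0
  ^-nonZero (suc k) x≉0 = *-nonZero x≉0 (^-nonZero k x≉0)

  ^-zero : ∀ {x} k → x ≈ 0# → x ^ suc k ≈ 0#
  ^-zero k x≈0 = trans (*-congʳ x≈0) (zeroˡ _)

  1^k≈1 : ∀ k → 1# ^ k ≈ 1#
  1^k≈1 zero    = refl
  1^k≈1 (suc k) = trans (*-identityˡ _) (1^k≈1 k)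

  nonZeros : List Carrier
  nonZeros = elements ─ complete 0#

  nonZeros-unique : Unique nonZeros
  nonZeros-unique = unique-─ distinct (complete 0#)

  ∈-nonZeros : ∀ {x} → ¬ x ≈ 0# → x ∈ nonZeros
  ∈-nonZeros x≉0 = ∈-─ elements (complete 0#) (complete _) x≉0

  ∈-nonZeros⇒≉0 : ∀ {x} → x ∈ nonZeros → ¬ x ≈ 0#
  ∈-nonZeros⇒≉0 = ∈-─⇒≉ distinct (complete 0#)

  length-elements─ : ∀ {x} (x∈F : x ∈ elements) → length (elements ─ x∈F) ≡ q ∸ 1
  length-elements─ _ = ≡.trans (List.length-removeAt elements _) (ℕP.pred[m∸n]≡m∸[1+n] q 0)

  ∏-nonZero : ∀ xs → (∀ {x} → x ∈ xs → ¬ x ≈ 0#) → ¬ ∏ xs (λ x → x) ≈ 0#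
  ∏-nonZero []       _      = 1≉0
  ∏-nonZero (x ∷ xs) xs≉0 = *-nonZero (xs≉0 (here refl)) (∏-nonZero xs (xs≉0 ∘ there))

  ∏-const : ∀ x xs → ∏ xs (λ _ → x) ≈ x ^ length xs
  ∏-const x []       = refl
  ∏-const x (_ ∷ xs) = *-congˡ (∏-const x xs)

  -- Multiplication by x permutes the nonzero elements, so x ^ (q - 1) ∏ y = ∏ x y = ∏ y.
  x^[q∸1]≈1 : ∀ {x} → ¬ x ≈ 0# → x ^ (q ∸ 1) ≈ 1#
  x^[q∸1]≈1 {x} x≉0 = *-cancelʳ-nonZero (∏-nonZero nonZeros ∈-nonZeros⇒≉0) (begin
    x ^ (q ∸ 1) * P                        ≡⟨ ≡.cong (λ k → x ^ k * P) (length-elements─ (complete 0#)) ⟨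
    x ^ length nonZeros * P                ≈⟨ *-congʳ (∏-const x nonZeros) ⟨
    ∏ nonZeros (λ _ → x) * P               ≈⟨ ∏-* nonZeros ⟨
    ∏ nonZeros (x *_)                      ≈⟨ ∏-reindex (x *_) id nonZeros-unique
                                                (λ y∈ → ∈-nonZeros (*-nonZero x≉0 (∈-nonZeros⇒≉0 y∈)))
                                                (*-cancelˡ-nonZero x≉0) ⟩
    P                                      ≈⟨ *-identityˡ P ⟨
    1# * P                                 ∎)
    where
    P = ∏ nonZeros (λ y → y)

  q≡1+[q∸1] : q ≡ suc (q ∸ 1)
  q≡1+[q∸1] = ≡.trans (List.length-removeAt′ elements _) (≡.cong suc (length-elements─ (complete 0#)))

  x^q≈x : ∀ x → x ^ q ≈ x
  x^q≈x x = trans (reflexive (≡.cong (x ^_) q≡1+[q∸1])) (x^[1+[q∸1]]≈x (x ≟ 0#))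
    where
    x^[1+[q∸1]]≈x : Dec (x ≈ 0#) → x ^ suc (q ∸ 1) ≈ x
    x^[1+[q∸1]]≈x (yes x≈0) = trans (^-zero (q ∸ 1) x≈0) (sym x≈0)
    x^[1+[q∸1]]≈x (no  x≉0) = trans (*-congˡ (x^[q∸1]≈1 x≉0)) (*-identityʳ x)

  x^[k*[q∸1]]≈1 : ∀ {x} → ¬ x ≈ 0# → ∀ k → x ^ (k ℕ.* (q ∸ 1)) ≈ 1#
  x^[k*[q∸1]]≈1 {x} x≉0 k = begin
    x ^ (k ℕ.* (q ∸ 1))   ≡⟨ ≡.cong (x ^_) (ℕP.*-comm k (q ∸ 1)) ⟩
    x ^ ((q ∸ 1) ℕ.* k)   ≈⟨ ^-assocʳ x (q ∸ 1) k ⟨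
    (x ^ (q ∸ 1)) ^ k     ≈⟨ ^-congˡ k (x^[q∸1]≈1 x≉0) ⟩
    1# ^ k                ≈⟨ 1^k≈1 k ⟩
    1#                    ∎

  module PowerMap {d : ℕ} (1≤d : 1 ℕ.≤ d) (d⊥q∸1 : gcd d (q ∸ 1) ≡ 1) where

    ^d-zero : ∀ {x} → x ≈ 0# → x ^ d ≈ 0#
    ^d-zero {x} x≈0 =
      trans (reflexive (≡.cong (x ^_) (≡.sym (ℕP.suc-pred d {{ℕ.>-nonZero 1≤d}})))) (^-zero (ℕ.pred d) x≈0)

    private
      [x^d]^u : ∀ x u → (x ^ d) ^ u ≈ x ^ (u ℕ.* d)
      [x^d]^u x u = trans (^-assocʳ x d u) (reflexive (≡.cong (x ^_) (ℕP.*-comm d u)))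

    -- By Bézout either u d = 1 + v (q - 1), and then x = (x ^ d) ^ u, or u d + 1 = v (q - 1), and then
    -- (x ^ d) ^ u is the inverse of x.
    ^d-injective : ∀ {x y} → x ^ d ≈ y ^ d → x ≈ y
    ^d-injective {x} {y} x^d≈y^d with x ≟ 0# | y ≟ 0#
    ... | yes x≈0 | yes y≈0 = trans x≈0 (sym y≈0)
    ... | yes x≈0 | no  y≉0 = contradiction (trans (sym x^d≈y^d) (^d-zero x≈0)) (^-nonZero d y≉0)
    ... | no  x≉0 | yes y≈0 = contradiction (trans x^d≈y^d (^d-zero y≈0)) (^-nonZero d x≉0)
    ... | no  x≉0 | no  y≉0 with Bézout.identity (≡.subst (GCD d (q ∸ 1)) d⊥q∸1 (gcd-GCD d (q ∸ 1)))
    ...   | Bézout.+- u v 1+v[q∸1]≡ud = begin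
      x            ≈⟨ recover x≉0 ⟩
      (x ^ d) ^ u  ≈⟨ ^-congˡ u x^d≈y^d ⟩
      (y ^ d) ^ u  ≈⟨ recover y≉0 ⟨
      y            ∎
      where
      recover : ∀ {z} → ¬ z ≈ 0# → z ≈ (z ^ d) ^ u
      recover {z} z≉0 = begin
        z                          ≈⟨ *-identityʳ z ⟨
        z * 1#                     ≈⟨ *-congˡ (x^[k*[q∸1]]≈1 z≉0 v) ⟨
        z ^ (1 ℕ.+ v ℕ.* (q ∸ 1))  ≡⟨ ≡.cong (z ^_) 1+v[q∸1]≡ud ⟩
        z ^ (u ℕ.* d)              ≈⟨ [x^d]^u z u ⟨
        (z ^ d) ^ u                ∎
    ...   | Bézout.-+ u v 1+ud≡v[q∸1] =
      *-cancelʳ-nonZero (^-nonZero u (^-nonZero d y≉0)) (begin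
        x * (y ^ d) ^ u  ≈⟨ *-congˡ (^-congˡ u x^d≈y^d) ⟨
        x * (x ^ d) ^ u  ≈⟨ inverts x≉0 ⟩
        1#               ≈⟨ inverts y≉0 ⟨
        y * (y ^ d) ^ u  ∎)
      where
      inverts : ∀ {z} → ¬ z ≈ 0# → z * (z ^ d) ^ u ≈ 1#
      inverts {z} z≉0 = begin
        z * (z ^ d) ^ u            ≈⟨ *-congˡ ([x^d]^u z u) ⟩
        z ^ (1 ℕ.+ u ℕ.* d)        ≡⟨ ≡.cong (z ^_) 1+ud≡v[q∸1] ⟩
        z ^ (v ℕ.* (q ∸ 1))        ≈⟨ x^[k*[q∸1]]≈1 z≉0 v ⟩
        1#                         ∎

    ^d-surjective : ∀ y → ∃ λ x → y ≈ x ^ d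
    ^d-surjective = injective⇒surjective distinct complete ^d-injective

module Characteristic2 {c ℓ} (F : FiniteField c ℓ) (char2 : Char2 F) where

  open FiniteField F
  open FiniteFieldProperties F
  open import Algebra.Properties.AbelianGroup +-abelianGroup
    using (inverseʳ-unique; ∙-cancelʳ)
  open import Relation.Binary.Reasoning.Setoid setoid
  open ListSum (≡.setoid ℕ) +-commutativeMonoid
    renaming (∑ to ∑ᵢ; ∑-cong to ∑ᵢ-cong; ∑-∙ to ∑ᵢ-+; ∑-∷ʳ to ∑ᵢ-∷ʳ)

  x+x≈0 : ∀ x → x + x ≈ 0#
  x+x≈0 x = begin
    x + x              ≈⟨ +-cong (*-identityˡ x) (*-identityˡ x) ⟨
    1# * x + 1# * x    ≈⟨ distribʳ x 1# 1# ⟨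
    (1# + 1#) * x      ≈⟨ *-congʳ char2 ⟩
    0# * x             ≈⟨ zeroˡ x ⟩
    0#                 ∎

  -x≈x : ∀ x → - x ≈ x
  -x≈x x = sym (inverseʳ-unique x x (x+x≈0 x))

  x+y≈0⇒y≈x : ∀ {x y} → x + y ≈ 0# → y ≈ x
  x+y≈0⇒y≈x {x} {y} x+y≈0 = trans (inverseʳ-unique x y x+y≈0) (-x≈x x)

  x+[y+x]≈y : ∀ x y → x + (y + x) ≈ y
  x+[y+x]≈y x y = begin
    x + (y + x)   ≈⟨ +-congˡ (+-comm y x) ⟩
    x + (x + y)   ≈⟨ +-assoc x x y ⟨
    (x + x) + y   ≈⟨ +-congʳ (x+x≈0 x) ⟩
    0# + y        ≈⟨ +-identityˡ y ⟩
    y             ∎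

  [x+y]+[x′+y′]≈0 : ∀ {x y x′ y′} → x ≈ x′ → y ≈ y′ → (x + y) + (x′ + y′) ≈ 0#
  [x+y]+[x′+y′]≈0 x≈x′ y≈y′ = trans (+-congˡ (+-cong (sym x≈x′) (sym y≈y′))) (x+x≈0 _)

  +-cancelʳ : ∀ {x y} z → x + z ≈ y + z → x ≈ y
  +-cancelʳ z = ∙-cancelʳ z _ _

  x^2≈x*x : ∀ x → x ^ 2 ≈ x * x
  x^2≈x*x x = *-congˡ (*-identityʳ x)

  ^2-distrib-+ : ∀ x y → (x + y) ^ 2 ≈ x ^ 2 + y ^ 2
  ^2-distrib-+ x y = begin
    (x + y) ^ 2                          ≈⟨ x^2≈x*x (x + y) ⟩
    (x + y) * (x + y)                    ≈⟨ distribʳ _ _ _ ⟩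
    x * (x + y) + y * (x + y)            ≈⟨ +-cong (distribˡ _ _ _) (distribˡ _ _ _) ⟩
    (x * x + x * y) + (y * x + y * y)    ≈⟨ +-congˡ (+-congʳ (*-comm y x)) ⟩
    (x * x + x * y) + (x * y + y * y)    ≈⟨ +-assoc _ _ _ ⟩
    x * x + (x * y + (x * y + y * y))    ≈⟨ +-congˡ (+-assoc _ _ _) ⟨
    x * x + ((x * y + x * y) + y * y)    ≈⟨ +-congˡ (+-congʳ (x+x≈0 _)) ⟩
    x * x + (0# + y * y)                 ≈⟨ +-congˡ (+-identityˡ _) ⟩
    x * x + y * y                        ≈⟨ +-cong (x^2≈x*x x) (x^2≈x*x y) ⟨
    x ^ 2 + y ^ 2                        ∎

  ^2^[1+i]≈[^2^i]^2 : ∀ x i → x ^ (2 ℕ.^ suc i) ≈ (x ^ (2 ℕ.^ i)) ^ 2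
  ^2^[1+i]≈[^2^i]^2 x i = begin
    x ^ (2 ℕ.* 2 ℕ.^ i)   ≡⟨ ≡.cong (x ^_) (ℕP.*-comm 2 (2 ℕ.^ i)) ⟩
    x ^ (2 ℕ.^ i ℕ.* 2)   ≈⟨ ^-assocʳ x (2 ℕ.^ i) 2 ⟨
    (x ^ (2 ℕ.^ i)) ^ 2   ∎

  ^2^i-distrib-+ : ∀ x y i → (x + y) ^ (2 ℕ.^ i) ≈ x ^ (2 ℕ.^ i) + y ^ (2 ℕ.^ i)
  ^2^i-distrib-+ x y zero    = trans (*-identityʳ (x + y)) (+-cong (sym (*-identityʳ x)) (sym (*-identityʳ y)))
  ^2^i-distrib-+ x y (suc i) = begin
    (x + y) ^ (2 ℕ.^ suc i)                        ≈⟨ ^2^[1+i]≈[^2^i]^2 (x + y) i ⟩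
    ((x + y) ^ (2 ℕ.^ i)) ^ 2                      ≈⟨ ^-congˡ 2 (^2^i-distrib-+ x y i) ⟩
    (x ^ (2 ℕ.^ i) + y ^ (2 ℕ.^ i)) ^ 2            ≈⟨ ^2-distrib-+ _ _ ⟩
    (x ^ (2 ℕ.^ i)) ^ 2 + (y ^ (2 ℕ.^ i)) ^ 2      ≈⟨ +-cong (^2^[1+i]≈[^2^i]^2 x i) (^2^[1+i]≈[^2^i]^2 y i) ⟨
    x ^ (2 ℕ.^ suc i) + y ^ (2 ℕ.^ suc i)          ∎

  ∑ᵢ-^2 : ∀ is (g : ℕ → Carrier) → (∑ᵢ is g) ^ 2 ≈ ∑ᵢ is (λ i → g i ^ 2)
  ∑ᵢ-^2 []       g = ^-zero 1 refl
  ∑ᵢ-^2 (i ∷ is) g = trans (^2-distrib-+ _ _) (+-congˡ (∑ᵢ-^2 is g))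

  sumF≡foldr : ∀ xs → sumF F xs ≡ foldr _+_ 0# xs
  sumF≡foldr []       = ≡.refl
  sumF≡foldr (x ∷ xs) = ≡.cong (x +_) (sumF≡foldr xs)

  Tr≈∑ : ∀ n y → Tr F n y ≈ ∑ᵢ (upTo n) (λ i → y ^ (2 ℕ.^ i))
  Tr≈∑ n y = trans (reflexive (sumF≡foldr (map (λ i → pow F y (2 ℕ.^ i)) (upTo n))))
                   (∑ᵢ-cong (upTo n) (λ i → reflexive (pow≡^ y (2 ℕ.^ i))))

  Tr-cong : ∀ n {x y} → x ≈ y → Tr F n x ≈ Tr F n y
  Tr-cong n {x} {y} x≈y = begin
    Tr F n x                             ≈⟨ Tr≈∑ n x ⟩
    ∑ᵢ (upTo n) (λ i → x ^ (2 ℕ.^ i))    ≈⟨ ∑ᵢ-cong (upTo n) (λ i → ^-congˡ (2 ℕ.^ i) x≈y) ⟩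
    ∑ᵢ (upTo n) (λ i → y ^ (2 ℕ.^ i))    ≈⟨ Tr≈∑ n y ⟨
    Tr F n y                             ∎

  Tr-+ : ∀ n x y → Tr F n (x + y) ≈ Tr F n x + Tr F n y
  Tr-+ n x y = begin
    Tr F n (x + y)                                              ≈⟨ Tr≈∑ n (x + y) ⟩
    ∑ᵢ (upTo n) (λ i → (x + y) ^ (2 ℕ.^ i))                     ≈⟨ ∑ᵢ-cong (upTo n) (^2^i-distrib-+ x y) ⟩
    ∑ᵢ (upTo n) (λ i → x ^ (2 ℕ.^ i) + y ^ (2 ℕ.^ i))           ≈⟨ ∑ᵢ-+ (upTo n) ⟩
    ∑ᵢ (upTo n) (λ i → x ^ (2 ℕ.^ i)) + ∑ᵢ (upTo n) (λ i → y ^ (2 ℕ.^ i))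
                                                                ≈⟨ +-cong (Tr≈∑ n x) (Tr≈∑ n y) ⟨
    Tr F n x + Tr F n y                                         ∎

  Tr-0# : ∀ n → Tr F n 0# ≈ 0#
  Tr-0# n = +-cancelʳ (Tr F n 0#) (begin
    Tr F n 0# + Tr F n 0#   ≈⟨ Tr-+ n 0# 0# ⟨
    Tr F n (0# + 0#)        ≈⟨ Tr-cong n (+-identityˡ 0#) ⟩
    Tr F n 0#               ≈⟨ +-identityˡ _ ⟨
    0# + Tr F n 0#          ∎)

  -- Squaring shifts the terms y ^ 2 ^ i of the trace by one, and y ^ 2 ^ n ≈ y ≈ y ^ 2 ^ 0.
  Tr^2≈Tr : ∀ n → q ≡ 2 ℕ.^ n → ∀ y → Tr F n y ^ 2 ≈ Tr F n y
  Tr^2≈Tr n q≡2^n y = begin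
    Tr F n y ^ 2                          ≈⟨ ^-congˡ 2 (Tr≈∑ n y) ⟩
    ∑ᵢ (upTo n) g ^ 2                     ≈⟨ ∑ᵢ-^2 (upTo n) g ⟩
    ∑ᵢ (upTo n) (λ i → g i ^ 2)           ≈⟨ ∑ᵢ-cong (upTo n) (λ i → sym (^2^[1+i]≈[^2^i]^2 y i)) ⟩
    ∑ᵢ (upTo n) (g ∘ suc)                 ≈⟨ +-cancelʳ y shift ⟩
    ∑ᵢ (upTo n) g                         ≈⟨ Tr≈∑ n y ⟨
    Tr F n y                              ∎
    where
    g : ℕ → Carrier
    g i = y ^ (2 ℕ.^ i)
    shift : ∑ᵢ (upTo n) (g ∘ suc) + y ≈ ∑ᵢ (upTo n) g + y
    shift = begin
      ∑ᵢ (upTo n) (g ∘ suc) + y                ≈⟨ +-comm _ _ ⟩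
      y + ∑ᵢ (upTo n) (g ∘ suc)
        ≈⟨ +-cong (*-identityʳ y) (reflexive (≡.cong (foldr _+_ 0#) (≡.sym (List.map-∘ (upTo n))))) ⟨
      g 0 + ∑ᵢ (map suc (upTo n)) g
        ≡⟨ ≡.cong (λ is → g 0 + ∑ᵢ is g) (List.map-applyUpTo (λ i → i) suc n) ⟩
      ∑ᵢ (upTo (suc n)) g                      ≡⟨ ≡.cong (λ is → ∑ᵢ is g) (List.upTo-∷ʳ n) ⟨
      ∑ᵢ (upTo n ∷ʳ n) g                       ≈⟨ ∑ᵢ-∷ʳ (upTo n) n ⟩
      ∑ᵢ (upTo n) g + g n                      ≡⟨ ≡.cong (λ k → ∑ᵢ (upTo n) g + y ^ k) q≡2^n ⟨
      ∑ᵢ (upTo n) g + y ^ q                    ≈⟨ +-congˡ (x^q≈x y) ⟩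
      ∑ᵢ (upTo n) g + y                        ∎

  Tr∈𝔽₂ : ∀ n → q ≡ 2 ℕ.^ n → ∀ y → Tr F n y ≈ 0# ⊎ Tr F n y ≈ 1#
  Tr∈𝔽₂ n q≡2^n y with Tr F n y ≟ 0#
  ... | yes t≈0 = inj₁ t≈0
  ... | no  t≉0 = inj₂ (*-cancelʳ-nonZero t≉0 (begin
    Tr F n y * Tr F n y    ≈⟨ x^2≈x*x _ ⟨
    Tr F n y ^ 2           ≈⟨ Tr^2≈Tr n q≡2^n y ⟩
    Tr F n y               ≈⟨ *-identityˡ _ ⟨
    1# * Tr F n y          ∎))

module AdditiveCharacter {c ℓ} (F : FiniteField c ℓ) (char2 : Char2 F)
                         (n : ℕ) (q≡2^n : card F ≡ 2 ℕ.^ n) where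

  open FiniteField F
  open FiniteFieldProperties F
  open Characteristic2 F char2
  open import Data.Integer as ℤ using (ℤ; +_; -1ℤ)
  import Data.Integer.Properties as ℤP
  open IntegerSum setoid

  χ : Carrier → ℤ
  χ = sign F n

  χ≡1 : ∀ {y} → Tr F n y ≈ 0# → χ y ≡ + 1
  χ≡1 {y} Tr≈0 with Tr F n y ≟ 0#
  ... | yes _   = ≡.refl
  ... | no  Tr≉0 = contradiction Tr≈0 Tr≉0

  χ≡-1 : ∀ {y} → ¬ Tr F n y ≈ 0# → χ y ≡ -1ℤ
  χ≡-1 {y} Tr≉0 with Tr F n y ≟ 0#
  ... | yes Tr≈0 = contradiction Tr≈0 Tr≉0
  ... | no  _    = ≡.refl

  χ-cong : ∀ {x y} → x ≈ y → χ x ≡ χ y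
  χ-cong {x} {y} x≈y with Tr F n y ≟ 0#
  ... | yes Tr≈0 = χ≡1 (trans (Tr-cong n x≈y) Tr≈0)
  ... | no  Tr≉0 = χ≡-1 (λ Tr≈0 → Tr≉0 (trans (Tr-cong n (sym x≈y)) Tr≈0))

  χ-0# : ∀ {y} → y ≈ 0# → χ y ≡ + 1
  χ-0# y≈0 = χ≡1 (trans (Tr-cong n y≈0) (Tr-0# n))

  private
    ≈1⇒≉0 : ∀ {t} → t ≈ 1# → ¬ t ≈ 0#
    ≈1⇒≉0 t≈1 t≈0 = 1≉0 (trans (sym t≈1) t≈0)

    Tr[x+y]≈ : ∀ {x y s t u} → Tr F n x ≈ s → Tr F n y ≈ t → s + t ≈ u → Tr F n (x + y) ≈ u
    Tr[x+y]≈ {x} {y} x≈s y≈t s+t≈u = trans (Tr-+ n x y) (trans (+-cong x≈s y≈t) s+t≈u)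

  χ-+ : ∀ x y → χ (x + y) ≡ χ x ℤ.* χ y
  χ-+ x y with Tr∈𝔽₂ n q≡2^n x | Tr∈𝔽₂ n q≡2^n y
  ... | inj₁ x₀ | inj₁ y₀ rewrite χ≡1 x₀ | χ≡1 y₀ =
    χ≡1 (Tr[x+y]≈ x₀ y₀ (+-identityʳ 0#))
  ... | inj₁ x₀ | inj₂ y₁ rewrite χ≡1 x₀ | χ≡-1 (≈1⇒≉0 y₁) =
    χ≡-1 (≈1⇒≉0 (Tr[x+y]≈ x₀ y₁ (+-identityˡ 1#)))
  ... | inj₂ x₁ | inj₁ y₀ rewrite χ≡-1 (≈1⇒≉0 x₁) | χ≡1 y₀ =
    χ≡-1 (≈1⇒≉0 (Tr[x+y]≈ x₁ y₀ (+-identityʳ 1#)))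
  ... | inj₂ x₁ | inj₂ y₁ rewrite χ≡-1 (≈1⇒≉0 x₁) | χ≡-1 (≈1⇒≉0 y₁) =
    χ≡1 (Tr[x+y]≈ x₁ y₁ char2)

  ∑F : (Carrier → ℤ) → ℤ
  ∑F = ∑ elements

  syntax ∑F (λ x → e) = ∑[ x ] e

  ∑F-cong : ∀ {f g} → (∀ x → f x ≡ g x) → ∑F f ≡ ∑F g
  ∑F-cong = ∑-cong elements

  ∑F-reindex : ∀ (g : Carrier → ℤ) (h : Carrier → Carrier) → (∀ {x y} → x ≈ y → g x ≡ g y) →
               (∀ {x y} → h x ≈ h y → x ≈ y) → ∑[ x ] g (h x) ≡ ∑[ x ] g x
  ∑F-reindex g h g-cong h-inj = ∑-reindex h g-cong distinct (λ _ → complete _) h-inj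

  module NontrivialTrace {t : Carrier} (Tr[t]≉0 : ¬ Tr F n t ≈ 0#) where

    -- Translating by t multiplies the sum by χ t = -1.
    ∑χ≡0 : ∑[ x ] χ x ≡ + 0
    ∑χ≡0 = i≡-i⇒i≡0 (begin
      ∑[ x ] χ x               ≡⟨ ∑F-reindex χ (_+ t) χ-cong (+-cancelʳ t) ⟨
      ∑[ x ] χ (x + t)         ≡⟨ ∑F-cong (λ x → χ-+ x t) ⟩
      ∑[ x ] (χ x ℤ.* χ t)     ≡⟨ ∑-*ʳ (χ t) elements ⟨
      (∑[ x ] χ x) ℤ.* χ t     ≡⟨ ≡.cong (∑[ x ] χ x ℤ.*_) (χ≡-1 Tr[t]≉0) ⟩
      (∑[ x ] χ x) ℤ.* -1ℤ     ≡⟨ ℤP.*-comm _ -1ℤ ⟩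
      -1ℤ ℤ.* (∑[ x ] χ x)     ≡⟨ ℤP.-1*i≡-i _ ⟩
      ℤ.- (∑[ x ] χ x)         ∎)
      where
      open ≡.≡-Reasoning
      i≡-i⇒i≡0 : ∀ {i} → i ≡ ℤ.- i → i ≡ + 0
      i≡-i⇒i≡0 {+ zero}  _ = ≡.refl
      i≡-i⇒i≡0 {+ suc _} ()
      i≡-i⇒i≡0 {ℤ.-[1+ _ ]} ()

    χ-sum : Carrier → ℤ
    χ-sum s = ∑[ a ] χ (a * s)

    χ-sum-cong : ∀ {s s′} → s ≈ s′ → χ-sum s ≡ χ-sum s′
    χ-sum-cong s≈s′ = ∑F-cong (λ a → χ-cong (*-congˡ s≈s′))

    χ-sum-zero : ∀ {s} → s ≈ 0# → χ-sum s ≡ + q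
    χ-sum-zero {s} s≈0 = ≡.trans (∑F-cong (λ a → χ-0# (trans (*-congˡ s≈0) (zeroʳ a))))
                                 (≡.trans (∑-const (+ 1) elements) (ℤP.*-identityʳ _))

    χ-sum-nonZero : ∀ {s} → ¬ s ≈ 0# → χ-sum s ≡ + 0
    χ-sum-nonZero s≉0 = ≡.trans (∑F-reindex χ (_* _) χ-cong (*-cancelʳ-nonZero s≉0)) ∑χ≡0

    χ-sum-nonNeg : ∀ s → + 0 ℤ.≤ χ-sum s
    χ-sum-nonNeg s with s ≟ 0#
    ... | yes s≈0 = ≡.subst (+ 0 ℤ.≤_) (≡.sym (χ-sum-zero s≈0)) (ℤ.+≤+ ℕ.z≤n)
    ... | no  s≉0 = ≡.subst (+ 0 ℤ.≤_) (≡.sym (χ-sum-nonZero s≉0)) ℤP.≤-refl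

module WalshSpectrum {c ℓ} (F : FiniteField c ℓ) (char2 : Char2 F)
                     (n : ℕ) (q≡2^n : card F ≡ 2 ℕ.^ n)
                     {d : ℕ} (1≤d : 1 ℕ.≤ d) (d⊥q∸1 : gcd d (card F ∸ 1) ≡ 1) where

  open FiniteField F
  open FiniteFieldProperties F
  open PowerMap 1≤d d⊥q∸1
  open Characteristic2 F char2
  open AdditiveCharacter F char2 n q≡2^n
  open import Data.Integer as ℤ using (ℤ; +_)
  import Data.Integer.Properties as ℤP
  open IntegerSum setoid
  open IntegerArithmetic
  open UniqueList setoid using (∈-─⇒≉)
  open import Data.List.Membership.Setoid setoid using (_─_)
  open import Algebra.Properties.CommutativeSemigroup +-commutativeSemigroup
    using () renaming (interchange to +-interchange)

  Q M q³ 2q² : ℤ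
  Q = + q
  M = + (q ∸ 1)
  q³ = Q ℤ.* Q ²
  2q² = Q ² ℤ.+ Q ²

  ψ : Carrier → Carrier → Carrier → Carrier → ℤ
  ψ b a u v = χ (b * u + a * v)

  W : Carrier → Carrier → ℤ
  W b a = ∑[ x ] ψ b a (x ^ d) x

  ψ-cong : ∀ {b a u v b′ a′ u′ v′} → b ≈ b′ → a ≈ a′ → u ≈ u′ → v ≈ v′ →
           ψ b a u v ≡ ψ b′ a′ u′ v′
  ψ-cong b≈ a≈ u≈ v≈ = χ-cong (+-cong (*-cong b≈ u≈) (*-cong a≈ v≈))

  ψ-split : ∀ b a u v → ψ b a u v ≡ χ (b * u) ℤ.* χ (a * v)
  ψ-split b a u v = χ-+ (b * u) (a * v)

  ψ-* : ∀ b a u v u′ v′ → ψ b a u v ℤ.* ψ b a u′ v′ ≡ ψ b a (u + u′) (v + v′)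
  ψ-* b a u v u′ v′ = ≡.trans (≡.sym (χ-+ _ _)) (χ-cong (begin
    (b * u + a * v) + (b * u′ + a * v′)    ≈⟨ +-interchange _ _ _ _ ⟩
    (b * u + b * u′) + (a * v + a * v′)    ≈⟨ +-cong (distribˡ b u u′) (distribˡ a v v′) ⟨
    b * (u + u′) + a * (v + v′)            ∎))
    where open import Relation.Binary.Reasoning.Setoid setoid

  W-cong : ∀ {b a b′ a′} → b ≈ b′ → a ≈ a′ → W b a ≡ W b′ a′
  W-cong b≈ a≈ = ∑F-cong (λ x → ψ-cong b≈ a≈ refl refl)

  sumℤ≡∑ : ∀ {g} xs → sumℤ F (map g xs) ≡ ∑ xs g
  sumℤ≡∑ []           = ≡.refl
  sumℤ≡∑ {g} (x ∷ xs) = ≡.cong (ℤ._+_ (g x)) (sumℤ≡∑ xs)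

  walsh≡W : ∀ a → walsh F n d a ≡ W 1# a
  walsh≡W a = ≡.trans (sumℤ≡∑ elements) (∑F-cong (λ x → χ-cong (begin
    pow F x d - a * x      ≈⟨ +-cong (reflexive (pow≡^ x d)) (-x≈x (a * x)) ⟩
    x ^ d + a * x          ≈⟨ +-congʳ (*-identityˡ (x ^ d)) ⟨
    1# * x ^ d + a * x     ∎)))
    where open import Relation.Binary.Reasoning.Setoid setoid

  U V : Carrier → Carrier → Carrier → Carrier → Carrier
  U x z y w = (x ^ d + y ^ d) + (z ^ d + w ^ d)
  V x z y w = (x + y) + (z + w)

  W²-expand : ∀ b a → W b a ² ≡ ∑[ x ] ∑[ y ] ψ b a (x ^ d + y ^ d) (x + y)
  W²-expand b a = ≡.trans (∑-product elements elements)
                   (∑F-cong (λ x → ∑F-cong (λ y → ψ-* b a _ _ _ _)))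

  W⁴-expand : ∀ b a → W b a ⁴ ≡ ∑[ x ] ∑[ z ] ∑[ y ] ∑[ w ] ψ b a (U x z y w) (V x z y w)
  W⁴-expand b a = begin
    W b a ⁴
      ≡⟨ ≡.cong₂ ℤ._*_ (W²-expand b a) (W²-expand b a) ⟩
    (∑[ x ] ∑[ y ] ψ b a (x ^ d + y ^ d) (x + y)) ℤ.* (∑[ z ] ∑[ w ] ψ b a (z ^ d + w ^ d) (z + w))
      ≡⟨ ∑-product elements elements ⟩
    ∑[ x ] ∑[ z ] ((∑[ y ] ψ b a (x ^ d + y ^ d) (x + y)) ℤ.* (∑[ w ] ψ b a (z ^ d + w ^ d) (z + w)))
      ≡⟨ ∑F-cong (λ x → ∑F-cong (λ z → ≡.trans (∑-product elements elements)
           (∑F-cong (λ y → ∑F-cong (λ w → ψ-* b a _ _ _ _))))) ⟩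
    ∑[ x ] ∑[ z ] ∑[ y ] ∑[ w ] ψ b a (U x z y w) (V x z y w)
      ∎
    where open ≡.≡-Reasoning

  W-scale : ∀ {t} → ¬ t ≈ 0# → ∀ a → W (t ^ d) (a * t) ≡ W 1# a
  W-scale {t} t≉0 a = begin
    ∑[ x ] ψ (t ^ d) (a * t) (x ^ d) x
      ≡⟨ ∑F-cong (λ x → χ-cong (+-cong (scale x) (*-assoc a t x))) ⟩
    ∑[ x ] ψ 1# a ((t * x) ^ d) (t * x)
      ≡⟨ ∑F-reindex (λ y → ψ 1# a (y ^ d) y) (t *_) (λ y≈z → ψ-cong refl refl (^-congˡ d y≈z) y≈z)
                    (*-cancelˡ-nonZero t≉0) ⟩
    ∑[ x ] ψ 1# a (x ^ d) x
      ∎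
    where
    open ≡.≡-Reasoning
    scale : ∀ x → t ^ d * x ^ d ≈ 1# * (t * x) ^ d
    scale x = trans (sym (^-distrib-* t x d)) (sym (*-identityˡ _))

  ∑W⁴-scale : ∀ {b} → ¬ b ≈ 0# → ∑[ a ] (W b a ⁴) ≡ ∑[ a ] (W 1# a ⁴)
  ∑W⁴-scale {b} b≉0 with ^d-surjective b
  ... | t , b≈t^d = begin
    ∑[ a ] (W b a ⁴)               ≡⟨ ∑F-cong (λ a → ≡.cong _⁴ (W-cong b≈t^d refl)) ⟩
    ∑[ a ] (W (t ^ d) a ⁴)         ≡⟨ ∑F-reindex (λ a → W (t ^ d) a ⁴) (_* t)
                                         (λ a≈ → ≡.cong _⁴ (W-cong refl a≈)) (*-cancelʳ-nonZero t≉0) ⟨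
    ∑[ a ] (W (t ^ d) (a * t) ⁴)   ≡⟨ ∑F-cong (λ a → ≡.cong _⁴ (W-scale t≉0 a)) ⟩
    ∑[ a ] (W 1# a ⁴)              ∎
    where
    open ≡.≡-Reasoning
    t≉0 : ¬ t ≈ 0#
    t≉0 t≈0 = b≉0 (trans b≈t^d (^d-zero t≈0))

  Large : Carrier → Set ℓ
  Large a = ¬ a ≈ 0# × 2 ℕ.* q ℕ.≤ ℤ.∣ walsh F n d a ∣ ℕ.^ 2

  large? : ∀ a → Dec (Large a)
  large? a = ¬? (a ≟ 0#) ×-dec (2 ℕ.* q ℕ.≤? ℤ.∣ walsh F n d a ∣ ℕ.^ 2)

  Large-resp : ∀ {a a′} → a ≈ a′ → Large a → Large a′
  Large-resp {a} {a′} a≈a′ (a≉0 , large) = (λ a′≈0 → a≉0 (trans a≈a′ a′≈0)) ,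
    ≡.subst (λ w → 2 ℕ.* q ℕ.≤ ℤ.∣ w ∣ ℕ.^ 2) walsh[a]≡walsh[a′] large
    where
    walsh[a]≡walsh[a′] : walsh F n d a ≡ walsh F n d a′
    walsh[a]≡walsh[a′] = ≡.trans (walsh≡W a) (≡.trans (W-cong refl a≈a′) (≡.sym (walsh≡W a′)))

  module _ {t : Carrier} (Tr[t]≉0 : ¬ Tr F n t ≈ 0#) where

    open NontrivialTrace Tr[t]≉0

    ∑ψ-over-a : ∀ b u v → ∑[ a ] ψ b a u v ≡ χ (b * u) ℤ.* χ-sum v
    ∑ψ-over-a b u v = ≡.trans (∑F-cong (λ a → ψ-split b a u v)) (≡.sym (∑-*ˡ (χ (b * u)) elements))

    ∑∑ψ : ∀ u v → ∑[ b ] ∑[ a ] ψ b a u v ≡ χ-sum u ℤ.* χ-sum v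
    ∑∑ψ u v = ≡.trans (∑F-cong (λ b → ∑ψ-over-a b u v)) (≡.sym (∑-*ʳ (χ-sum v) elements))

    parseval : ∑[ a ] (W 1# a ²) ≡ Q ²
    parseval = begin
      ∑[ a ] (W 1# a ²)                                     ≡⟨ ∑F-cong (W²-expand 1#) ⟩
      ∑[ a ] ∑[ x ] ∑[ y ] ψ 1# a (x ^ d + y ^ d) (x + y)   ≡⟨ ∑-swap elements elements ⟩
      ∑[ x ] ∑[ a ] ∑[ y ] ψ 1# a (x ^ d + y ^ d) (x + y)   ≡⟨ ∑F-cong (λ x → ∑-swap elements elements) ⟩
      ∑[ x ] ∑[ y ] ∑[ a ] ψ 1# a (x ^ d + y ^ d) (x + y)   ≡⟨ ∑F-cong (λ x → ∑F-cong (λ y → ∑ψ-over-a 1# _ _)) ⟩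
      ∑[ x ] ∑[ y ] g x y                                   ≡⟨ ∑F-cong diagonal ⟩
      ∑[ x ] Q                                              ≡⟨ ∑-const Q elements ⟩
      Q ²                                                   ∎
      where
      open ≡.≡-Reasoning
      g : Carrier → Carrier → ℤ
      g x y = χ (1# * (x ^ d + y ^ d)) ℤ.* χ-sum (x + y)
      diagonal : ∀ x → ∑[ y ] g x y ≡ Q
      diagonal x = begin
        ∑[ y ] g x y   ≡⟨ ∑-single g-cong distinct (complete x) off-diagonal ⟩
        g x x          ≡⟨ ≡.cong₂ ℤ._*_ (χ-0# (trans (*-identityˡ _) (x+x≈0 _))) (χ-sum-zero (x+x≈0 x)) ⟩
        + 1 ℤ.* Q      ≡⟨ ℤP.*-identityˡ Q ⟩
        Q              ∎
        where
        g-cong : ∀ {y y′} → y ≈ y′ → g x y ≡ g x y′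
        g-cong y≈ = ≡.cong₂ ℤ._*_ (χ-cong (*-congˡ (+-congˡ (^-congˡ d y≈)))) (χ-sum-cong (+-congˡ y≈))
        off-diagonal : ∀ y → ¬ y ≈ x → g x y ≡ + 0
        off-diagonal y y≉x rewrite χ-sum-nonZero (y≉x ∘ x+y≈0⇒y≈x) = ℤP.*-zeroʳ (χ (1# * (x ^ d + y ^ d)))

    W[1,0]≡0 : W 1# 0# ≡ + 0
    W[1,0]≡0 = begin
      ∑[ x ] ψ 1# 0# (x ^ d) x
        ≡⟨ ∑F-cong (λ x → χ-cong (trans (+-cong (*-identityˡ _) (zeroˡ x)) (+-identityʳ _))) ⟩
      ∑[ x ] χ (x ^ d)
        ≡⟨ ∑F-reindex χ (_^ d) χ-cong ^d-injective ⟩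
      ∑[ x ] χ x
        ≡⟨ ∑χ≡0 ⟩
      + 0
        ∎
      where open ≡.≡-Reasoning

    W[0,a]≡χ-sum : ∀ a → W 0# a ≡ χ-sum a
    W[0,a]≡χ-sum a = ∑F-cong (λ x → χ-cong (trans (+-congʳ (zeroˡ _)) (trans (+-identityˡ _) (*-comm a x))))

    -- q² if x + y = z + w and x ^ d + y ^ d = z ^ d + w ^ d, and 0 otherwise.
    N : Carrier → Carrier → Carrier → Carrier → ℤ
    N x z y w = χ-sum (U x z y w) ℤ.* χ-sum (V x z y w)

    ∑∑W⁴≡∑N : ∑[ b ] ∑[ a ] (W b a ⁴) ≡ ∑[ x ] ∑[ z ] ∑[ y ] ∑[ w ] N x z y w
    ∑∑W⁴≡∑N = begin
      ∑[ b ] ∑[ a ] (W b a ⁴)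
        ≡⟨ ∑F-cong (λ b → ∑F-cong (W⁴-expand b)) ⟩
      ∑[ b ] ∑[ a ] ∑[ x ] ∑[ z ] ∑[ y ] ∑[ w ] ψ b a (U x z y w) (V x z y w)
        ≡⟨ ∑-pull L L L ⟩
      ∑[ x ] ∑[ b ] ∑[ a ] ∑[ z ] ∑[ y ] ∑[ w ] ψ b a (U x z y w) (V x z y w)
        ≡⟨ ∑F-cong (λ x → ∑-pull L L L) ⟩
      ∑[ x ] ∑[ z ] ∑[ b ] ∑[ a ] ∑[ y ] ∑[ w ] ψ b a (U x z y w) (V x z y w)
        ≡⟨ ∑F-cong (λ x → ∑F-cong (λ z → ∑-pull L L L)) ⟩
      ∑[ x ] ∑[ z ] ∑[ y ] ∑[ b ] ∑[ a ] ∑[ w ] ψ b a (U x z y w) (V x z y w)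
        ≡⟨ ∑F-cong (λ x → ∑F-cong (λ z → ∑F-cong (λ y → ∑-pull L L L))) ⟩
      ∑[ x ] ∑[ z ] ∑[ y ] ∑[ w ] ∑[ b ] ∑[ a ] ψ b a (U x z y w) (V x z y w)
        ≡⟨ ∑F-cong (λ x → ∑F-cong (λ z → ∑F-cong (λ y → ∑F-cong (λ w → ∑∑ψ _ _)))) ⟩
      ∑[ x ] ∑[ z ] ∑[ y ] ∑[ w ] N x z y w
        ∎
      where
      open ≡.≡-Reasoning
      L = elements

    N-cong : ∀ {x z y w x′ z′ y′ w′} → x ≈ x′ → z ≈ z′ → y ≈ y′ → w ≈ w′ →
             N x z y w ≡ N x′ z′ y′ w′
    N-cong x≈ z≈ y≈ w≈ = ≡.cong₂ ℤ._*_
      (χ-sum-cong (+-cong (+-cong (^-congˡ d x≈) (^-congˡ d y≈)) (+-cong (^-congˡ d z≈) (^-congˡ d w≈))))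
      (χ-sum-cong (+-cong (+-cong x≈ y≈) (+-cong z≈ w≈)))

    N-nonNeg : ∀ x z y w → + 0 ℤ.≤ N x z y w
    N-nonNeg x z y w = *-nonNeg (χ-sum-nonNeg _) (χ-sum-nonNeg _)

    D : Carrier → Carrier → Carrier → Carrier
    D x z y = U x z y ((x + y) + z)

    D-cong : ∀ x z {y y′} → y ≈ y′ → D x z y ≈ D x z y′
    D-cong x z y≈ = +-cong (+-congˡ (^-congˡ d y≈)) (+-congˡ (^-congˡ d (+-congʳ (+-congˡ y≈))))

    -- w = x + y + z solves the linear equation, which makes the second factor of N equal to q.
    ∑N-over-w : ∀ x z y → χ-sum (D x z y) ℤ.* Q ℤ.≤ ∑[ w ] N x z y w
    ∑N-over-w x z y = ≡.subst (ℤ._≤ ∑[ w ] N x z y w)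
      (≡.cong (χ-sum (D x z y) ℤ.*_) (χ-sum-zero (trans (+-congˡ (x+[y+x]≈y z (x + y))) (x+x≈0 (x + y)))))
      (∑-≥-term (N-cong refl refl refl) (N-nonNeg x z y) (complete ((x + y) + z)))

    D[x,x,y]≈0 : ∀ x y → D x x y ≈ 0#
    D[x,x,y]≈0 x y = [x+y]+[x′+y′]≈0 refl (sym (^-congˡ d (trans (+-assoc x y x) (x+[y+x]≈y x y))))

    D[x,z,x]≈0 : ∀ x z → D x z x ≈ 0#
    D[x,z,x]≈0 x z = trans (+-interchange _ _ _ _)
      ([x+y]+[x′+y′]≈0 refl (sym (^-congˡ d (trans (+-congʳ (x+x≈0 x)) (+-identityˡ z)))))

    D[x,z,z]≈0 : ∀ x z → D x z z ≈ 0#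
    D[x,z,z]≈0 x z = trans (+-congˡ (+-comm _ _))
      ([x+y]+[x′+y′]≈0 (sym (^-congˡ d (trans (+-assoc x z z) (trans (+-congˡ (x+x≈0 z)) (+-identityʳ x))))) refl)

    ∑N-diag : ∀ x → q³ ℤ.≤ ∑[ y ] ∑[ w ] N x x y w
    ∑N-diag x = begin
      q³                               ≡⟨ ∑-const (Q ²) elements ⟨
      ∑[ y ] (Q ²)                     ≡⟨ ∑F-cong (λ y → ≡.cong (ℤ._* Q) (χ-sum-zero (D[x,x,y]≈0 x y))) ⟨
      ∑[ y ] (χ-sum (D x x y) ℤ.* Q)   ≤⟨ ∑-mono-≤ elements (λ {y} _ → ∑N-over-w x x y) ⟩
      ∑[ y ] ∑[ w ] N x x y w          ∎
      where open ℤP.≤-Reasoning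

    ∑N-offDiag : ∀ {x z} → ¬ z ≈ x → 2q² ℤ.≤ ∑[ y ] ∑[ w ] N x z y w
    ∑N-offDiag {x} {z} z≉x = begin
      2q²
        ≡⟨ ≡.cong₂ ℤ._+_ (D≈0⇒ (D[x,z,x]≈0 x z)) (D≈0⇒ (D[x,z,z]≈0 x z)) ⟨
      χ-sum (D x z x) ℤ.* Q ℤ.+ χ-sum (D x z z) ℤ.* Q
        ≤⟨ ∑-≥-pair (λ y≈ → ≡.cong (ℤ._* Q) (χ-sum-cong (D-cong x z y≈)))
                    (λ y → *-nonNeg (χ-sum-nonNeg (D x z y)) (ℤ.+≤+ ℕ.z≤n))
                    (complete x) (complete z) z≉x ⟩
      ∑[ y ] (χ-sum (D x z y) ℤ.* Q)
        ≤⟨ ∑-mono-≤ elements (λ {y} _ → ∑N-over-w x z y) ⟩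
      ∑[ y ] ∑[ w ] N x z y w
        ∎
      where
      open ℤP.≤-Reasoning
      D≈0⇒ : ∀ {y} → D x z y ≈ 0# → χ-sum (D x z y) ℤ.* Q ≡ Q ²
      D≈0⇒ D≈0 = ≡.cong (ℤ._* Q) (χ-sum-zero D≈0)

    ∑N≥ : Q ℤ.* (q³ ℤ.+ M ℤ.* 2q²) ℤ.≤ ∑[ x ] ∑[ z ] ∑[ y ] ∑[ w ] N x z y w
    ∑N≥ = begin
      Q ℤ.* (q³ ℤ.+ M ℤ.* 2q²)                ≡⟨ ∑-const _ elements ⟨
      ∑[ x ] (q³ ℤ.+ M ℤ.* 2q²)               ≤⟨ ∑-mono-≤ elements (λ {x} _ → ∑N-over-z x) ⟩
      ∑[ x ] ∑[ z ] ∑[ y ] ∑[ w ] N x z y w   ∎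
      where
      open ℤP.≤-Reasoning
      ∑N-over-z : ∀ x → q³ ℤ.+ M ℤ.* 2q² ℤ.≤ ∑[ z ] ∑[ y ] ∑[ w ] N x z y w
      ∑N-over-z x = begin
        q³ ℤ.+ M ℤ.* 2q²
          ≡⟨ ≡.cong (λ k → q³ ℤ.+ + k ℤ.* 2q²) (length-elements─ x∈F) ⟨
        q³ ℤ.+ + length (elements ─ x∈F) ℤ.* 2q²
          ≡⟨ ≡.cong (ℤ._+_ q³) (∑-const _ (elements ─ x∈F)) ⟨
        q³ ℤ.+ ∑ (elements ─ x∈F) (λ _ → 2q²)
          ≤⟨ ℤP.+-mono-≤ (∑N-diag x) (∑-mono-≤ (elements ─ x∈F) (∑N-offDiag ∘ ∈-─⇒≉ distinct x∈F)) ⟩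
        row x ℤ.+ ∑ (elements ─ x∈F) row
          ≡⟨ ∑-─ (λ z≈ → ∑F-cong (λ y → ∑F-cong (λ w → N-cong refl z≈ refl refl))) x∈F ⟨
        ∑F row
          ∎
        where
        x∈F = complete x
        row : Carrier → ℤ
        row z = ∑[ y ] ∑[ w ] N x z y w

    s₄ : ℤ
    s₄ = ∑[ a ] (W 1# a ⁴)

    ∑W[0,a]⁴ : ∑[ a ] (W 0# a ⁴) ≡ Q ⁴
    ∑W[0,a]⁴ = begin
      ∑[ a ] (W 0# a ⁴)       ≡⟨ ∑F-cong (λ a → ≡.cong _⁴ (W[0,a]≡χ-sum a)) ⟩
      ∑[ a ] (χ-sum a ⁴)      ≡⟨ ∑-single (λ a≈ → ≡.cong _⁴ (χ-sum-cong a≈)) distinct (complete 0#)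
                                   (λ a a≉0 → ≡.cong _⁴ (χ-sum-nonZero a≉0)) ⟩
      χ-sum 0# ⁴              ≡⟨ ≡.cong _⁴ (χ-sum-zero refl) ⟩
      Q ⁴                     ∎
      where open ≡.≡-Reasoning

    -- b = 0 contributes q ⁴, and each of the q - 1 nonzero b contributes s₄.
    ∑∑W⁴≡ : ∑[ b ] ∑[ a ] (W b a ⁴) ≡ Q ⁴ ℤ.+ M ℤ.* s₄
    ∑∑W⁴≡ = begin
      ∑[ b ] ∑[ a ] (W b a ⁴)
        ≡⟨ ∑-─ (λ b≈ → ∑F-cong (λ a → ≡.cong _⁴ (W-cong b≈ refl))) (complete 0#) ⟩
      ∑[ a ] (W 0# a ⁴) ℤ.+ ∑ nonZeros (λ b → ∑[ a ] (W b a ⁴))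
        ≡⟨ ≡.cong₂ ℤ._+_ ∑W[0,a]⁴ (∑-cong-∈ nonZeros (∑W⁴-scale ∘ ∈-nonZeros⇒≉0)) ⟩
      Q ⁴ ℤ.+ ∑ nonZeros (λ _ → s₄)
        ≡⟨ ≡.cong (ℤ._+_ (Q ⁴)) (∑-const s₄ nonZeros) ⟩
      Q ⁴ ℤ.+ + length nonZeros ℤ.* s₄
        ≡⟨ ≡.cong (λ k → Q ⁴ ℤ.+ + k ℤ.* s₄) (length-elements─ (complete 0#)) ⟩
      Q ⁴ ℤ.+ M ℤ.* s₄
        ∎
      where open ≡.≡-Reasoning

    s₄≤ : ∀ B → (∀ a → ¬ a ≈ 0# → W 1# a ² ℤ.≤ B) → s₄ ℤ.≤ B ℤ.* Q ²
    s₄≤ B W²≤B = begin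
      ∑[ a ] (W 1# a ⁴)          ≤⟨ ∑-mono-≤ elements (λ {a} _ → W⁴≤B*W² a) ⟩
      ∑[ a ] (B ℤ.* W 1# a ²)    ≡⟨ ∑-*ˡ B elements ⟨
      B ℤ.* ∑[ a ] (W 1# a ²)    ≡⟨ ≡.cong (B ℤ.*_) parseval ⟩
      B ℤ.* Q ²                  ∎
      where
      open ℤP.≤-Reasoning
      W⁴≤B*W² : ∀ a → W 1# a ⁴ ℤ.≤ B ℤ.* W 1# a ²
      W⁴≤B*W² a with a ≟ 0#
      ... | yes a≈0 = ℤP.≤-reflexive (begin-equality
        W 1# a ⁴            ≡⟨ ≡.cong _⁴ W[1,a]≡0 ⟩
        + 0                 ≡⟨ ℤP.*-zeroʳ B ⟨
        B ℤ.* (+ 0) ²       ≡⟨ ≡.cong (λ w → B ℤ.* w ²) W[1,a]≡0 ⟨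
        B ℤ.* W 1# a ²      ∎)
        where W[1,a]≡0 = ≡.trans (W-cong refl a≈0) W[1,0]≡0
      ... | no  a≉0 = ℤP.*-monoʳ-≤-nonNeg (W 1# a ²) {{ℤ.nonNegative (i²-nonNeg (W 1# a))}} (W²≤B a a≉0)

    ∃-large-nontrivial : 2 ℕ.≤ q → ∃ Large
    ∃-large-nontrivial 2≤q with any? large? elements
    ... | yes ∃large = satisfied ∃large
    ... | no  ∄large = contradiction upper (moment-bounds-incompatible s₄ q≡1+[q∸1] 1≤q∸1 lower)
      where
      1≤q∸1 : 1 ℕ.≤ q ∸ 1
      1≤q∸1 = ℕP.∸-monoˡ-≤ 1 2≤q
      lower : Q ℤ.* (q³ ℤ.+ M ℤ.* 2q²) ℤ.≤ Q ⁴ ℤ.+ M ℤ.* s₄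
      lower = ≡.subst (Q ℤ.* (q³ ℤ.+ M ℤ.* 2q²) ℤ.≤_) (≡.trans (≡.sym ∑∑W⁴≡∑N) ∑∑W⁴≡) ∑N≥
      W²≤ : ∀ a → ¬ a ≈ 0# → W 1# a ² ℤ.≤ M ℤ.+ Q
      W²≤ a a≉0 = begin
        W 1# a ²                               ≡⟨ ≡.cong _² (walsh≡W a) ⟨
        walsh F n d a ²                        ≡⟨ i²≡+∣i∣^2 (walsh F n d a) ⟩
        + ∣walsh∣²                             ≤⟨ ℤ.+≤+ (ℕP.≤-pred (≡.subst (∣walsh∣² ℕ.<_) 2q≡1+[q∸1+q] ∣walsh∣²<2q)) ⟩
        + ((q ∸ 1) ℕ.+ q)                      ≡⟨ ℤP.pos-+ (q ∸ 1) q ⟩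
        M ℤ.+ Q                                ∎
        where
        open ℤP.≤-Reasoning
        ∣walsh∣² = ℤ.∣ walsh F n d a ∣ ℕ.^ 2
        ∣walsh∣²<2q : ∣walsh∣² ℕ.< 2 ℕ.* q
        ∣walsh∣²<2q = ℕP.≰⇒> (λ large → ∄large (Any.map (λ a≈ → Large-resp a≈ (a≉0 , large)) (complete a)))
        2q≡1+[q∸1+q] : 2 ℕ.* q ≡ suc ((q ∸ 1) ℕ.+ q)
        2q≡1+[q∸1+q] = ≡.trans (≡.cong (q ℕ.+_) (ℕP.+-identityʳ q)) (≡.cong (ℕ._+ q) q≡1+[q∸1])
      upper : s₄ ℤ.≤ (M ℤ.+ Q) ℤ.* Q ²
      upper = s₄≤ _ W²≤

  -- The trace of a finite field is never identically zero, but that case is also easy to handle directly.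
  ∃-large : 2 ℕ.≤ q → ∃ Large
  ∃-large 2≤q with any? (λ t → ¬? (Tr F n t ≟ 0#)) elements
  ... | yes ∃Tr≉0 = ∃-large-nontrivial (proj₂ (satisfied ∃Tr≉0)) 2≤q
  ... | no  ∄Tr≉0 = 1# , 1≉0 , ≡.subst (λ w → 2 ℕ.* q ℕ.≤ ℤ.∣ w ∣ ℕ.^ 2) (≡.sym walsh[1]≡q) 2q≤q^2
    where
    Tr≈0 : ∀ x → Tr F n x ≈ 0#
    Tr≈0 x with Tr F n x ≟ 0#
    ... | yes Tr≈0 = Tr≈0
    ... | no  Tr≉0 = contradiction (Any.map (λ x≈ Tr≈0 → Tr≉0 (trans (Tr-cong n x≈) Tr≈0)) (complete x)) ∄Tr≉0
    walsh[1]≡q : walsh F n d 1# ≡ + q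
    walsh[1]≡q = begin
      walsh F n d 1#      ≡⟨ walsh≡W 1# ⟩
      W 1# 1#             ≡⟨ ∑F-cong (λ x → χ≡1 (Tr≈0 _)) ⟩
      ∑[ x ] (+ 1)        ≡⟨ ∑-const (+ 1) elements ⟩
      + q ℤ.* + 1         ≡⟨ ℤP.*-identityʳ (+ q) ⟩
      + q                 ∎
      where open ≡.≡-Reasoning
    2q≤q^2 : 2 ℕ.* q ℕ.≤ q ℕ.^ 2
    2q≤q^2 = ≡.subst (2 ℕ.* q ℕ.≤_) (≡.cong (q ℕ.*_) (≡.sym (ℕP.*-identityʳ q))) (ℕP.*-monoˡ-≤ q 2≤q)

open import Data.Nat using (_≤_; _*_; _^_)
open import Data.Nat.DivMod using (_%_)
open import Data.Integer using (∣_∣)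

2≤2^n : ∀ n → n % 2 ≡ 1 → 2 ≤ 2 ^ n
2≤2^n (suc n) _ = ℕP.*-monoʳ-≤ 2 (ℕP.m^n>0 2 n)

mainTheorem2 : ∀ {c ℓ} (F : FiniteField c ℓ) (n d : ℕ)
    → Char2 F
    → card F ≡ 2 ^ n
    → n % 2 ≡ 1
    → 1 ≤ d
    → gcd d (card F ∸ 1) ≡ 1
    → Σ (FiniteField.Carrier F) (λ a → ¬ (FiniteField._≈_ F a (FiniteField.0# F))
    × 2 * card F ≤ ∣ walsh F n d a ∣ ^ 2)
mainTheorem2 F n d char2 q≡2^n n-odd 1≤d d⊥q∸1 =
  WalshSpectrum.∃-large F char2 n q≡2^n 1≤d d⊥q∸1 (≡.subst (2 ≤_) (≡.sym q≡2^n) (2≤2^n n n-odd))
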